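{- Let $G$ be a finite simple connected walk-regular graph. For a vertex $v$ and $m\ge 3$ let $\mathcal C_m(v)$ be the number of $m$-cycles of $G$ passing through $v$. Then (1) $\mathcal C_3(v)$, $\mathcal C_4(v)$ and $\mathcal C_5(v)$ are each independent of the vertex $v$; (2) if the common value $\mathcal C_3$ of $\mathcal C_3(v)$ satisfies $\mathcal C_3\le 1$, then $\mathcal C_6(v)$ is also independent of $v$.
   Context: A graph with adjacency matrix $A$ is walk-regular if for every $k\ge0$ the number $(A^k)_{v,v}$ of closed walks of length $k$ at $v$ is independent of $v$. An $m$-cycle is a cycle subgraph with $m$ vertices. -}

module Defs where

open import Data.Nat using (ℕ; zero; suc; _+_; _*_; _∸_; _/_; _<_)
open import Data.Bool using (Bool; true; false; _∧_; not; if_then_else_)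
open import Data.Fin using (Fin)
open import Data.Fin.Properties using (_≟_)
open import Data.List using (List; []; _∷_; [_]; _++_; map; concatMap; filterᵇ; length)
open import Data.Nat.ListAction using (sum)
open import Data.Bool.ListAction using (any)
open import Data.List.Base using (allFin)
open import Data.Vec using (Vec; toList) renaming ([] to []ᵥ; _∷_ to _∷ᵥ_)
open import Relation.Binary.PropositionalEquality using (_≡_)
open import Relation.Nullary.Decidable using (⌊_⌋)

record Graph : Set where
  field
    n      : ℕ
    adj    : Fin n → Fin n → Bool
    sym    : ∀ u v → adj u v ≡ adj v u
    irrefl : ∀ v → adj v v ≡ false
open Graph public

module _ (G : Graph) where
  private
    N = n G
    A = adj G

  Aent : Fin N → Fin N → ℕ
  Aent u w = if A u w then 1 else 0

  Apow : ℕ → Fin N → Fin N → ℕ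
  Apow zero    u w = if ⌊ u ≟ w ⌋ then 1 else 0
  Apow (suc k) u w = sum (map (λ x → Aent u x * Apow k x w) (allFin N))

  data Walk : Fin N → Fin N → Set where
    here : ∀ {u} → Walk u u
    step : ∀ {u x w} → A u x ≡ true → Walk x w → Walk u w

  Connected : Set
  Connected = ∀ u w → Walk u w

  WalkRegular : Set
  WalkRegular = ∀ (k : ℕ) (u w : Fin N) → Apow k u u ≡ Apow k w w

  allSeqs : (m : ℕ) → List (Vec (Fin N) m)
  allSeqs zero    = [ []ᵥ ]
  allSeqs (suc m) = concatMap (λ x → map (x ∷ᵥ_) (allSeqs m)) (allFin N)

  distinctᵇ : List (Fin N) → Bool
  distinctᵇ []       = true
  distinctᵇ (x ∷ xs) = not (any (λ y → ⌊ x ≟ y ⌋) xs) ∧ distinctᵇ xs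

  chainᵇ : List (Fin N) → Bool
  chainᵇ []           = true
  chainᵇ (x ∷ [])     = true
  chainᵇ (x ∷ y ∷ xs) = A x y ∧ chainᵇ (y ∷ xs)

  isCycleSeqᵇ : Fin N → List (Fin N) → Bool
  isCycleSeqᵇ v xs = distinctᵇ (v ∷ xs) ∧ chainᵇ ((v ∷ xs) ++ [ v ])

  cycleSeqsAt : ℕ → Fin N → ℕ
  cycleSeqsAt m v = length (filterᵇ (λ xs → isCycleSeqᵇ v (toList xs)) (allSeqs (m ∸ 1)))

  -- 𝒞_m(v): number of m-cycles (cycle subgraphs with m vertices) through v, m ≥ 3.
  -- Each such cycle corresponds to exactly 2 sequences above (the two orientations).
  cyclesThrough : ℕ → Fin N → ℕ
  cyclesThrough m v = cycleSeqsAt m v / 2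

module Submission where

open import Defs hiding (sym)
open import Agda.Builtin.FromNat using (Number; fromNat)
import Algebra.Properties.CommutativeSemigroup as CommutativeSemigroupProperties
open import Data.Bool using (Bool; true; false; not; _∧_; _∨_; if_then_else_; T)
open import Data.Bool.ListAction using (any)
open import Data.Bool.Properties using (T-∧; T-∨)
open import Data.Empty using (⊥-elim)
open import Data.Fin using (Fin; zero; suc; fromℕ)
import Data.Fin.Literals as Fin
open import Data.Fin.Properties using (_≟_)
open import Data.List using (List; []; _∷_; _++_; map; allFin; tabulate; filterᵇ; length; concatMap)
open import Data.List.Properties using (map-++; map-tabulate; map-∘)
open import Data.List.Relation.Unary.All using (All; []; _∷_; all?)
open import Data.List.Relation.Unary.Unique.Propositional using (Unique; []; _∷_)
open import Data.Nat using (ℕ; zero; suc; _+_; _*_; _≤_; z≤n)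
open import Data.Nat.DivMod using (_/_; _%_; m≡m%n+[m/n]*n; m%n<n)
import Data.Nat.ListAction as List using (sum)
open import Data.Nat.ListAction.Properties using (sum-++)
import Data.Nat.Literals as ℕ
open import Data.Nat.Properties hiding (_≟_)
open import Algebra.Properties.Semiring.Sum +-*-semiring
  using (sum; sum-syntax; sum-cong-≗; ∑-distrib-+; ∑-comm; *-distribˡ-sum; *-distribʳ-sum; sum-replicate-zero)
open import Data.Product using (_×_; _,_; proj₁)
open import Data.Sum using (_⊎_; inj₁; inj₂)
open import Data.Unit using (tt)
open import Data.Vec using (Vec; []; _∷_; lookup; toList)
open import Function using (_∘_; id)
open import Function.Bundles using (Equivalence)
open import Relation.Binary.PropositionalEquality
open import Relation.Nullary using (¬_; Dec; yes; no; contradiction)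
open import Relation.Nullary.Decidable using (⌊_⌋; ⌊⌋-map′; _×-dec_; _⊎-dec_; toWitness; fromWitness; T?)

-- Let Pₖ(u, w) count the non-backtracking walks of length k from u to w. They satisfy
-- P₂ = A² − D and Pₖ₊₂ = A Pₖ₊₁ − (D − I) Pₖ, so in a regular graph every Pₖ is a polynomial in A.
-- A walk-regular graph is regular (deg v = (A²)ᵥᵥ), hence the number Pₖ(v, v) of closed
-- non-backtracking k-walks at v does not depend on v. For k = 3, 4 these walks are exactly the
-- k-cycles through v, each traversed from v in both directions. For k = 5 the only other ones are
-- the tadpoles v a b c a v, and their number Σₐ A_va P₃(a, a) − 2 P₃(v, v) is invariant as well.
-- For k = 6 there are moreover the tadpoles v a b c e a v and the walks containing two triangles
-- through one vertex; if every vertex lies on at most one triangle, the latter are just the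
-- triangles through v traversed twice, counted by P₃(v, v).

instance
  ℕ-number : Number ℕ
  ℕ-number = ℕ.number

  Fin-number : ∀ {n} → Number (Fin n)
  Fin-number {n} = Fin.number n

module *-CS = CommutativeSemigroupProperties *-commutativeSemigroup
module +-CS = CommutativeSemigroupProperties +-commutativeSemigroup

-- Finite sums

𝟙 : Bool → ℕ
𝟙 b = if b then 1 else 0

δ δᶜ : ∀ {n} → Fin n → Fin n → ℕ
δ  x y = 𝟙 ⌊ x ≟ y ⌋
δᶜ x y = 𝟙 (not ⌊ x ≟ y ⌋)

𝟙-∧ : ∀ a b → 𝟙 (a ∧ b) ≡ 𝟙 a * 𝟙 b
𝟙-∧ true  b = sym (+-identityʳ (𝟙 b))
𝟙-∧ false b = refl

δᶜ-≢ : ∀ {n} {x y : Fin n} → x ≢ y → δᶜ x y ≡ 1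
δᶜ-≢ {x = x} {y} x≢y with x ≟ y
... | yes x≡y = contradiction x≡y x≢y
... | no _    = refl

δᶜ-δ-split : ∀ {n} (x y : Fin n) m → m ≡ δᶜ x y * m + δ x y * m
δᶜ-δ-split x y m with ⌊ x ≟ y ⌋
... | true  = sym (+-identityʳ m)
... | false = sym (trans (+-identityʳ (m + 0)) (+-identityʳ m))

sum-allFin : ∀ {n} (f : Fin n → ℕ) → List.sum (map f (allFin n)) ≡ sum f
sum-allFin {n} f = trans (cong List.sum (map-tabulate id f)) (sum-tabulate f)
  where
  sum-tabulate : ∀ {n} (f : Fin n → ℕ) → List.sum (tabulate f) ≡ sum f
  sum-tabulate {zero}  f = refl
  sum-tabulate {suc n} f = cong (f zero +_) (sum-tabulate (f ∘ suc))

∑-δ : ∀ {n} (a : Fin n) (f : Fin n → ℕ) → ∑[ x < n ] (δ x a * f x) ≡ f a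
∑-δ {suc n} zero    f = trans (cong (1 * f zero +_) (sum-replicate-zero n)) (trans (+-identityʳ _) (*-identityˡ _))
∑-δ {suc n} (suc a) f = trans (sum-cong-≗ δ-suc) (∑-δ a (f ∘ suc))
  where
  δ-suc : ∀ x → δ (suc x) (suc a) * f (suc x) ≡ δ x a * f (suc x)
  δ-suc x = cong (λ b → 𝟙 b * f (suc x)) (⌊⌋-map′ _ _ (x ≟ a))

∑-δʳ : ∀ {n} (a : Fin n) (f : Fin n → ℕ) → ∑[ x < n ] (f x * δ x a) ≡ f a
∑-δʳ a f = trans (sum-cong-≗ (λ x → *-comm (f x) (δ x a))) (∑-δ a f)

∑-δᶜ-split : ∀ {n} (a : Fin n) (f : Fin n → ℕ) → sum f ≡ ∑[ x < n ] (δᶜ x a * f x) + f a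
∑-δᶜ-split {n} a f = begin
  sum f                                                  ≡⟨ sum-cong-≗ (λ x → δᶜ-δ-split x a (f x)) ⟩
  ∑[ x < n ] (δᶜ x a * f x + δ x a * f x)                ≡⟨ ∑-distrib-+ (λ x → δᶜ x a * f x) (λ x → δ x a * f x) ⟩
  ∑[ x < n ] (δᶜ x a * f x) + ∑[ x < n ] (δ x a * f x)   ≡⟨ cong (∑[ x < n ] (δᶜ x a * f x) +_) (∑-δ a f) ⟩
  ∑[ x < n ] (δᶜ x a * f x) + f a                        ∎
  where open ≡-Reasoning

sum-map-≤-∑ : ∀ {n} {xs : List (Fin n)} (f : Fin n → ℕ) → Unique xs → List.sum (map f xs) ≤ sum f
sum-map-≤-∑ {xs = []}     f []           = z≤n
sum-map-≤-∑ {xs = x ∷ xs} f (x∉xs ∷ uxs) = begin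
  f x + List.sum (map f xs)  ≡⟨ cong (λ s → f x + List.sum s) (map-outside x∉xs) ⟩
  f x + List.sum (map g xs)  ≤⟨ +-monoʳ-≤ (f x) (sum-map-≤-∑ g uxs) ⟩
  f x + sum g                ≡⟨ +-comm (f x) (sum g) ⟩
  sum g + f x                ≡⟨ ∑-δᶜ-split x f ⟨
  sum f                      ∎
  where
  open ≤-Reasoning
  g = λ y → δᶜ y x * f y
  map-outside : ∀ {ys} → All (x ≢_) ys → map f ys ≡ map g ys
  map-outside []                   = refl
  map-outside {y ∷ _} (x≢y ∷ x∉ys) =
    cong₂ _∷_ (sym (trans (cong (_* f y) (δᶜ-≢ (≢-sym x≢y))) (*-identityˡ (f y)))) (map-outside x∉ys)

length-≤-∑ : ∀ {n} {xs : List (Fin n)} (f : Fin n → ℕ) → Unique xs → All (λ x → f x ≡ 1) xs → length xs ≤ sum f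
length-≤-∑ f unique ones = subst (_≤ sum f) (sum-ones ones) (sum-map-≤-∑ f unique)
  where
  sum-ones : ∀ {ys} → All (λ y → f y ≡ 1) ys → List.sum (map f ys) ≡ length ys
  sum-ones []           = refl
  sum-ones (fy≡1 ∷ fys) = cong₂ _+_ fy≡1 (sum-ones fys)

∑ⱽ : ∀ {n} k → (Vec (Fin n) k → ℕ) → ℕ
∑ⱽ     zero    f = f []
∑ⱽ {n} (suc k) f = ∑[ x < n ] ∑ⱽ k (λ xs → f (x ∷ xs))

module _ {n : ℕ} where

  ∑ⱽ-cong : ∀ k {f g : Vec (Fin n) k → ℕ} → (∀ xs → f xs ≡ g xs) → ∑ⱽ k f ≡ ∑ⱽ k g
  ∑ⱽ-cong zero    f≗g = f≗g []
  ∑ⱽ-cong (suc k) f≗g = sum-cong-≗ (λ x → ∑ⱽ-cong k (λ xs → f≗g (x ∷ xs)))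

  ∑ⱽ-distrib-+ : ∀ k (f g : Vec (Fin n) k → ℕ) → ∑ⱽ k (λ xs → f xs + g xs) ≡ ∑ⱽ k f + ∑ⱽ k g
  ∑ⱽ-distrib-+ zero    f g = refl
  ∑ⱽ-distrib-+ (suc k) f g = trans
    (sum-cong-≗ (λ x → ∑ⱽ-distrib-+ k (λ xs → f (x ∷ xs)) (λ xs → g (x ∷ xs))))
    (∑-distrib-+ (λ x → ∑ⱽ k (λ xs → f (x ∷ xs))) (λ x → ∑ⱽ k (λ xs → g (x ∷ xs))))

  *-distribˡ-∑ⱽ : ∀ k c (f : Vec (Fin n) k → ℕ) → c * ∑ⱽ k f ≡ ∑ⱽ k (λ xs → c * f xs)
  *-distribˡ-∑ⱽ zero    c f = refl
  *-distribˡ-∑ⱽ (suc k) c f = trans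
    (*-distribˡ-sum c (λ x → ∑ⱽ k (λ xs → f (x ∷ xs))))
    (sum-cong-≗ (λ x → *-distribˡ-∑ⱽ k c (λ xs → f (x ∷ xs))))

  ∑ⱽ-zero : ∀ k {f : Vec (Fin n) k → ℕ} → (∀ xs → f xs ≡ 0) → ∑ⱽ k f ≡ 0
  ∑ⱽ-zero zero    f≡0 = f≡0 []
  ∑ⱽ-zero (suc k) f≡0 = trans (sum-cong-≗ (λ x → ∑ⱽ-zero k (λ xs → f≡0 (x ∷ xs)))) (sum-replicate-zero n)

  ∑ⱽ-δ : ∀ k (a : Fin n) (f : Fin n → Vec (Fin n) k → ℕ) →
         ∑[ x < n ] ∑ⱽ k (λ xs → δ x a * f x xs) ≡ ∑ⱽ k (f a)
  ∑ⱽ-δ k a f = trans (sum-cong-≗ (λ x → sym (*-distribˡ-∑ⱽ k (δ x a) (f x)))) (∑-δ a (λ x → ∑ⱽ k (f x)))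

-- Indicator monomials

-- A monomial in the vertex variables 0, …, k − 1 is a list of literals: adjacency, distinctness
-- and equality of two variables. Its value at a vertex assignment is the product of the 0/1 values
-- of its literals. Such values are compared syntactically: M ⊩ L holds when every literal of L is
-- trivial or follows from a single literal of M, by symmetry or because adjacent vertices differ.

infix 8 _~_ _≠_ _≐_

data Literal (k : ℕ) : Set where
  _~_ _≠_ _≐_ : Fin k → Fin k → Literal k

Monomial : ℕ → Set
Monomial k = List (Literal k)

module _ {k : ℕ} where

  samePair : Fin k → Fin k → Fin k → Fin k → Bool
  samePair i j i′ j′ = ⌊ (i ≟ i′ ×-dec j ≟ j′) ⊎-dec (i ≟ j′ ×-dec j ≟ i′) ⌋

  _entails_ : Literal k → Literal k → Bool
  (i ~ j) entails (i′ ~ j′) = samePair i j i′ j′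
  (i ~ j) entails (i′ ≠ j′) = samePair i j i′ j′
  (i ≠ j) entails (i′ ≠ j′) = samePair i j i′ j′
  (i ≐ j) entails (i′ ≐ j′) = samePair i j i′ j′
  _       entails _         = false

  trivial : Literal k → Bool
  trivial (i ≐ j) = ⌊ i ≟ j ⌋
  trivial _       = false

  infix 7 _⊢_ _⊩_

  _⊢_ : Monomial k → Literal k → Bool
  []      ⊢ l = trivial l
  (m ∷ M) ⊢ l = m entails l ∨ M ⊢ l

  _⊩_ : Monomial k → Monomial k → Bool
  M ⊩ []      = true
  M ⊩ (l ∷ L) = M ⊢ l ∧ M ⊩ L

_at_ : ∀ {k k′} → Monomial k → Vec (Fin k′) k → Monomial k′
M at σ = map rename M
  where
  rename : Literal _ → Literal _
  rename (i ~ j) = lookup σ i ~ lookup σ j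
  rename (i ≠ j) = lookup σ i ≠ lookup σ j
  rename (i ≐ j) = lookup σ i ≐ lookup σ j

nbWalkMonomial : ∀ {k} → List (Fin k) → Monomial k
nbWalkMonomial (i ∷ j ∷ l ∷ is) = i ~ j ∷ l ≠ i ∷ nbWalkMonomial (j ∷ l ∷ is)
nbWalkMonomial (i ∷ j ∷ [])     = i ~ j ∷ []
nbWalkMonomial _                = []

chainMonomial : ∀ {k} → List (Fin k) → Monomial k
chainMonomial (i ∷ j ∷ is) = i ~ j ∷ chainMonomial (j ∷ is)
chainMonomial _            = []

distinctMonomial : ∀ {k} → List (Fin k) → Monomial k
distinctMonomial []       = []
distinctMonomial (i ∷ is) = map (i ≠_) is ++ distinctMonomial is

-- the non-backtracking walk 0 1 ⋯ k 0, whose turn k → 0 → 1 may backtrack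
closedNbWalk : ∀ k → Monomial (suc k)
closedNbWalk k = nbWalkMonomial (allFin (suc k) ++ zero ∷ [])

cycle : ∀ k → Monomial (suc k)
cycle k = distinctMonomial (allFin (suc k)) ++ chainMonomial (allFin (suc k) ++ zero ∷ [])

map-lookup-allFin : ∀ {A : Set} {k} (vs : Vec A k) → map (lookup vs) (allFin k) ≡ toList vs
map-lookup-allFin vs = trans (map-tabulate id (lookup vs)) (tabulate-lookup vs)
  where
  tabulate-lookup : ∀ {k} (vs : Vec _ k) → tabulate (lookup vs) ≡ toList vs
  tabulate-lookup []       = refl
  tabulate-lookup (v ∷ vs) = cong (v ∷_) (tabulate-lookup vs)

length-filterᵇ : ∀ {A : Set} (p : A → Bool) xs → length (filterᵇ p xs) ≡ List.sum (map (𝟙 ∘ p) xs)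
length-filterᵇ p []       = refl
length-filterᵇ p (x ∷ xs) with p x
... | true  = cong suc (length-filterᵇ p xs)
... | false = length-filterᵇ p xs

sum-map-concatMap : ∀ {A B : Set} (f : B → ℕ) (g : A → List B) xs →
                    List.sum (map f (concatMap g xs)) ≡ List.sum (map (λ x → List.sum (map f (g x))) xs)
sum-map-concatMap f g []       = refl
sum-map-concatMap f g (x ∷ xs) = begin
  List.sum (map f (g x ++ concatMap g xs))                   ≡⟨ cong List.sum (map-++ f (g x) (concatMap g xs)) ⟩
  List.sum (map f (g x) ++ map f (concatMap g xs))           ≡⟨ sum-++ (map f (g x)) _ ⟩
  List.sum (map f (g x)) + List.sum (map f (concatMap g xs)) ≡⟨ cong (List.sum (map f (g x)) +_) (sum-map-concatMap f g xs) ⟩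
  List.sum (map f (g x)) + List.sum (map (λ x → List.sum (map f (g x))) xs) ∎
  where open ≡-Reasoning

half≤1⇒≤3 : ∀ m → m / 2 ≤ 1 → m ≤ 3
half≤1⇒≤3 m half≤1 = begin
  m                   ≡⟨ m≡m%n+[m/n]*n m 2 ⟩
  m % 2 + m / 2 * 2   ≤⟨ +-mono-≤ (≤-pred (m%n<n m 2)) (*-monoˡ-≤ 2 half≤1) ⟩
  3                   ∎
  where open ≤-Reasoning

module _ (G : Graph) where

  private
    N = n G

  V : Set
  V = Fin N

  Matrix : Set
  Matrix = V → V → ℕ

  A : Matrix
  A = Aent G

  A-sym : ∀ u w → A u w ≡ A w u
  A-sym u w = cong 𝟙 (Graph.sym G u w)

  A*A : ∀ u w → A u w * A u w ≡ A u w
  A*A u w with adj G u w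
  ... | true  = refl
  ... | false = refl

  A*-idem : ∀ u w m → A u w * (A u w * m) ≡ A u w * m
  A*-idem u w m = trans (sym (*-assoc (A u w) (A u w) m)) (cong (_* m) (A*A u w))

  A·_ : Matrix → Matrix
  (A· M) u w = ∑[ x < N ] (A u x * M x w)

  deg : V → ℕ
  deg u = ∑[ x < N ] A u x

  Apow-suc : ∀ k u w → Apow G (suc k) u w ≡ (A· Apow G k) u w
  Apow-suc k u w = sum-allFin (λ x → A u x * Apow G k x w)

  Apow-2-diagonal : ∀ u → Apow G 2 u u ≡ deg u
  Apow-2-diagonal u = trans (Apow-suc 1 u u) (sum-cong-≗ λ x →
    trans (cong (A u x *_) (trans (Apow-1 x u) (A-sym x u))) (A*A u x))
    where
    Apow-1 : ∀ u w → Apow G 1 u w ≡ A u w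
    Apow-1 u w = trans (Apow-suc 0 u w) (∑-δʳ w (A u))

  walkRegular⇒regular : WalkRegular G → ∀ u w → deg u ≡ deg w
  walkRegular⇒regular wr u w = begin
    deg u         ≡⟨ Apow-2-diagonal u ⟨
    Apow G 2 u u  ≡⟨ wr 2 u w ⟩
    Apow G 2 w w  ≡⟨ Apow-2-diagonal w ⟩
    deg w         ∎
    where open ≡-Reasoning

  -- Non-backtracking walks

  -- nbWalksFrom j p u w counts the non-backtracking walks u → w of length j whose first step avoids p
  nbWalksFrom : ℕ → V → Matrix
  nbWalksFrom zero    p u w = δ u w
  nbWalksFrom (suc j) p u w = ∑[ x < N ] (A u x * (δᶜ x p * nbWalksFrom j u x w))

  nbWalks : ℕ → Matrix
  nbWalks zero    u w = δ u w
  nbWalks (suc j) u w = ∑[ x < N ] (A u x * nbWalksFrom j u x w)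

  nbWalks-split : ∀ j p u w → nbWalks (suc j) u w ≡ nbWalksFrom (suc j) p u w + A u p * nbWalksFrom j u p w
  nbWalks-split j p u w = trans (∑-δᶜ-split p (λ x → A u x * nbWalksFrom j u x w))
    (cong (_+ A u p * nbWalksFrom j u p w) (sum-cong-≗ (λ x → *-CS.x∙yz≈y∙xz (δᶜ x p) (A u x) _)))

  A·nbWalks : ∀ j u w →
    (A· nbWalks (suc j)) u w ≡ nbWalks (2 + j) u w + ∑[ x < N ] (A u x * nbWalksFrom j x u w)
  A·nbWalks j u w = begin
    ∑[ x < N ] (A u x * nbWalks (suc j) x w)
      ≡⟨ sum-cong-≗ (λ x → cong (A u x *_) (nbWalks-split j u x w)) ⟩
    ∑[ x < N ] (A u x * (nbWalksFrom (suc j) u x w + A x u * nbWalksFrom j x u w))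
      ≡⟨ sum-cong-≗ (λ x → *-distribˡ-+ (A u x) _ _) ⟩
    ∑[ x < N ] (A u x * nbWalksFrom (suc j) u x w + A u x * (A x u * nbWalksFrom j x u w))
      ≡⟨ ∑-distrib-+ (λ x → A u x * nbWalksFrom (suc j) u x w) _ ⟩
    nbWalks (2 + j) u w + ∑[ x < N ] (A u x * (A x u * nbWalksFrom j x u w))
      ≡⟨ cong (nbWalks (2 + j) u w +_) (sum-cong-≗ backtrack) ⟩
    nbWalks (2 + j) u w + ∑[ x < N ] (A u x * nbWalksFrom j x u w)
      ∎
    where
    open ≡-Reasoning
    backtrack : ∀ x → A u x * (A x u * nbWalksFrom j x u w) ≡ A u x * nbWalksFrom j x u w
    backtrack x = trans (cong (λ a → A u x * (a * nbWalksFrom j x u w)) (A-sym x u)) (A*-idem u x _)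

  deg*nbWalks : ∀ j u w →
    deg u * nbWalks (suc j) u w ≡ ∑[ x < N ] (A u x * nbWalksFrom (suc j) x u w) + nbWalks (suc j) u w
  deg*nbWalks j u w = begin
    deg u * nbWalks (suc j) u w
      ≡⟨ *-distribʳ-sum (nbWalks (suc j) u w) (A u) ⟩
    ∑[ x < N ] (A u x * nbWalks (suc j) u w)
      ≡⟨ sum-cong-≗ (λ x → cong (A u x *_) (nbWalks-split j x u w)) ⟩
    ∑[ x < N ] (A u x * (nbWalksFrom (suc j) x u w + A u x * nbWalksFrom j u x w))
      ≡⟨ sum-cong-≗ (λ x → trans (*-distribˡ-+ (A u x) _ _) (cong (A u x * nbWalksFrom (suc j) x u w +_) (A*-idem u x _))) ⟩
    ∑[ x < N ] (A u x * nbWalksFrom (suc j) x u w + A u x * nbWalksFrom j u x w)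
      ≡⟨ ∑-distrib-+ (λ x → A u x * nbWalksFrom (suc j) x u w) _ ⟩
    ∑[ x < N ] (A u x * nbWalksFrom (suc j) x u w) + nbWalks (suc j) u w
      ∎
    where open ≡-Reasoning

  nbWalks-2 : ∀ u w → nbWalks 2 u w + deg u * nbWalks 0 u w ≡ (A· nbWalks 1) u w
  nbWalks-2 u w = begin
    nbWalks 2 u w + deg u * δ u w                            ≡⟨ cong (nbWalks 2 u w +_) (*-distribʳ-sum (δ u w) (A u)) ⟩
    nbWalks 2 u w + ∑[ x < N ] (A u x * nbWalksFrom 0 x u w) ≡⟨ A·nbWalks 0 u w ⟨
    (A· nbWalks 1) u w                                       ∎
    where open ≡-Reasoning

  nbWalks-3+ : ∀ j u w →
    nbWalks (3 + j) u w + deg u * nbWalks (1 + j) u w ≡ (A· nbWalks (2 + j)) u w + nbWalks (1 + j) u w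
  nbWalks-3+ j u w = begin
    nbWalks (3 + j) u w + deg u * nbWalks (1 + j) u w      ≡⟨ cong (nbWalks (3 + j) u w +_) (deg*nbWalks j u w) ⟩
    nbWalks (3 + j) u w + (backtracks + nbWalks (1 + j) u w) ≡⟨ +-assoc (nbWalks (3 + j) u w) backtracks _ ⟨
    nbWalks (3 + j) u w + backtracks + nbWalks (1 + j) u w   ≡⟨ cong (_+ nbWalks (1 + j) u w) (A·nbWalks (suc j) u w) ⟨
    (A· nbWalks (2 + j)) u w + nbWalks (1 + j) u w         ∎
    where
    open ≡-Reasoning
    backtracks = ∑[ x < N ] (A u x * nbWalksFrom (suc j) x u w)

  evalFrom : List ℕ → ℕ → Matrix
  evalFrom []       k u w = 0
  evalFrom (c ∷ cs) k u w = c * Apow G k u w + evalFrom cs (suc k) u w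

  _⊕_ : List ℕ → List ℕ → List ℕ
  []      ⊕ q       = q
  (a ∷ p) ⊕ []      = a ∷ p
  (a ∷ p) ⊕ (b ∷ q) = (a + b) ∷ (p ⊕ q)

  _⊛_ : ℕ → List ℕ → List ℕ
  c ⊛ p = map (c *_) p

  evalFrom-⊕ : ∀ p q k u w → evalFrom (p ⊕ q) k u w ≡ evalFrom p k u w + evalFrom q k u w
  evalFrom-⊕ []      q       k u w = refl
  evalFrom-⊕ (a ∷ p) []      k u w = sym (+-identityʳ _)
  evalFrom-⊕ (a ∷ p) (b ∷ q) k u w = begin
    (a + b) * Aᵏ + evalFrom (p ⊕ q) (suc k) u w
      ≡⟨ cong₂ _+_ (*-distribʳ-+ Aᵏ a b) (evalFrom-⊕ p q (suc k) u w) ⟩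
    (a * Aᵏ + b * Aᵏ) + (evalFrom p (suc k) u w + evalFrom q (suc k) u w)
      ≡⟨ +-CS.interchange (a * Aᵏ) (b * Aᵏ) _ _ ⟩
    (a * Aᵏ + evalFrom p (suc k) u w) + (b * Aᵏ + evalFrom q (suc k) u w)
      ∎
    where
    open ≡-Reasoning
    Aᵏ = Apow G k u w

  evalFrom-⊛ : ∀ c p k u w → evalFrom (c ⊛ p) k u w ≡ c * evalFrom p k u w
  evalFrom-⊛ c []      k u w = sym (*-zeroʳ c)
  evalFrom-⊛ c (a ∷ p) k u w =
    trans (cong₂ _+_ (*-assoc c a _) (evalFrom-⊛ c p (suc k) u w)) (sym (*-distribˡ-+ c _ _))

  A·evalFrom : ∀ p k u w → (A· evalFrom p k) u w ≡ evalFrom p (suc k) u w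
  A·evalFrom []      k u w = trans (sum-cong-≗ (λ x → *-zeroʳ (A u x))) (sum-replicate-zero N)
  A·evalFrom (c ∷ p) k u w = begin
    ∑[ x < N ] (A u x * (c * Apow G k x w + evalFrom p (suc k) x w))
      ≡⟨ sum-cong-≗ (λ x → *-distribˡ-+ (A u x) _ _) ⟩
    ∑[ x < N ] (A u x * (c * Apow G k x w) + A u x * evalFrom p (suc k) x w)
      ≡⟨ ∑-distrib-+ (λ x → A u x * (c * Apow G k x w)) _ ⟩
    ∑[ x < N ] (A u x * (c * Apow G k x w)) + (A· evalFrom p (suc k)) u w
      ≡⟨ cong₂ _+_ scalar (A·evalFrom p (suc k) u w) ⟩
    c * Apow G (suc k) u w + evalFrom p (suc (suc k)) u w
      ∎
    where
    open ≡-Reasoning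
    scalar : ∑[ x < N ] (A u x * (c * Apow G k x w)) ≡ c * Apow G (suc k) u w
    scalar = begin
      ∑[ x < N ] (A u x * (c * Apow G k x w))  ≡⟨ sum-cong-≗ (λ x → *-CS.x∙yz≈y∙xz (A u x) c _) ⟩
      ∑[ x < N ] (c * (A u x * Apow G k x w))  ≡⟨ *-distribˡ-sum c (λ x → A u x * Apow G k x w) ⟨
      c * (A· Apow G k) u w                    ≡⟨ cong (c *_) (Apow-suc k u w) ⟨
      c * Apow G (suc k) u w                   ∎

  evalFrom-diagonal : WalkRegular G → ∀ p k u w → evalFrom p k u u ≡ evalFrom p k w w
  evalFrom-diagonal wr []      k u w = refl
  evalFrom-diagonal wr (c ∷ p) k u w = cong₂ _+_ (cong (c *_) (wr k u w)) (evalFrom-diagonal wr p (suc k) u w)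

  -- M = p(A) − q(A), stated without subtraction
  record PolynomialInA (M : Matrix) : Set where
    field
      p q   : List ℕ
      M+q≡p : ∀ u w → M u w + evalFrom q 0 u w ≡ evalFrom p 0 u w

  open PolynomialInA

  polynomial-δ : PolynomialInA δ
  polynomial-δ = record
    { p = 1 ∷ [] ; q = [] ; M+q≡p = λ u w → cong (_+ 0) (sym (*-identityˡ (δ u w))) }

  polynomial-A· : ∀ {M} → PolynomialInA M → PolynomialInA (A· M)
  polynomial-A· {M} poly = record { p = 0 ∷ p poly ; q = 0 ∷ q poly ; M+q≡p = λ u w → begin
    (A· M) u w + evalFrom (q poly) 1 u w                     ≡⟨ cong ((A· M) u w +_) (A·evalFrom (q poly) 0 u w) ⟨
    (A· M) u w + (A· evalFrom (q poly) 0) u w                ≡⟨ ∑-distrib-+ (λ x → A u x * M x w) _ ⟨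
    ∑[ x < N ] (A u x * M x w + A u x * evalFrom (q poly) 0 x w) ≡⟨ sum-cong-≗ (λ x → *-distribˡ-+ (A u x) _ _) ⟨
    (A· (λ x y → M x y + evalFrom (q poly) 0 x y)) u w       ≡⟨ sum-cong-≗ (λ x → cong (A u x *_) (M+q≡p poly x w)) ⟩
    (A· evalFrom (p poly) 0) u w                             ≡⟨ A·evalFrom (p poly) 0 u w ⟩
    evalFrom (p poly) 1 u w                                  ∎ }
    where open ≡-Reasoning

  polynomial-+ : ∀ {M M′} → PolynomialInA M → PolynomialInA M′ → PolynomialInA (λ u w → M u w + M′ u w)
  polynomial-+ {M} {M′} poly poly′ = record { p = p poly ⊕ p poly′ ; q = q poly ⊕ q poly′ ; M+q≡p = λ u w → begin
    M u w + M′ u w + evalFrom (q poly ⊕ q poly′) 0 u w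
      ≡⟨ cong (M u w + M′ u w +_) (evalFrom-⊕ (q poly) (q poly′) 0 u w) ⟩
    (M u w + M′ u w) + (evalFrom (q poly) 0 u w + evalFrom (q poly′) 0 u w) ≡⟨ +-CS.interchange (M u w) (M′ u w) _ _ ⟩
    (M u w + evalFrom (q poly) 0 u w) + (M′ u w + evalFrom (q poly′) 0 u w) ≡⟨ cong₂ _+_ (M+q≡p poly u w) (M+q≡p poly′ u w) ⟩
    evalFrom (p poly) 0 u w + evalFrom (p poly′) 0 u w                      ≡⟨ evalFrom-⊕ (p poly) (p poly′) 0 u w ⟨
    evalFrom (p poly ⊕ p poly′) 0 u w                                       ∎ }
    where open ≡-Reasoning

  polynomial-* : ∀ c {M} → PolynomialInA M → PolynomialInA (λ u w → c * M u w)
  polynomial-* c {M} poly = record { p = c ⊛ p poly ; q = c ⊛ q poly ; M+q≡p = λ u w → begin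
    c * M u w + evalFrom (c ⊛ q poly) 0 u w   ≡⟨ cong (c * M u w +_) (evalFrom-⊛ c (q poly) 0 u w) ⟩
    c * M u w + c * evalFrom (q poly) 0 u w   ≡⟨ *-distribˡ-+ c (M u w) _ ⟨
    c * (M u w + evalFrom (q poly) 0 u w)     ≡⟨ cong (c *_) (M+q≡p poly u w) ⟩
    c * evalFrom (p poly) 0 u w               ≡⟨ evalFrom-⊛ c (p poly) 0 u w ⟨
    evalFrom (c ⊛ p poly) 0 u w               ∎ }
    where open ≡-Reasoning

  polynomial-cancel : ∀ {X Y Z} → PolynomialInA X → PolynomialInA Y →
                      (∀ u w → Z u w + Y u w ≡ X u w) → PolynomialInA Z
  polynomial-cancel {X} {Y} {Z} polyX polyY Z+Y≡X = record
    { p = p polyX ⊕ q polyY ; q = p polyY ⊕ q polyX ; M+q≡p = λ u w → begin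
    Z u w + evalFrom (p polyY ⊕ q polyX) 0 u w      ≡⟨ cong (Z u w +_) (evalFrom-⊕ (p polyY) (q polyX) 0 u w) ⟩
    Z u w + (evalFrom (p polyY) 0 u w + qX u w)     ≡⟨ cong (λ t → Z u w + (t + qX u w)) (M+q≡p polyY u w) ⟨
    Z u w + ((Y u w + qY u w) + qX u w)             ≡⟨ cong (Z u w +_) (+-CS.xy∙z≈xz∙y (Y u w) (qY u w) (qX u w)) ⟩
    Z u w + ((Y u w + qX u w) + qY u w)             ≡⟨ +-assoc (Z u w) _ (qY u w) ⟨
    (Z u w + (Y u w + qX u w)) + qY u w             ≡⟨ cong (_+ qY u w) (+-assoc (Z u w) (Y u w) (qX u w)) ⟨
    (Z u w + Y u w + qX u w) + qY u w               ≡⟨ cong (λ t → t + qX u w + qY u w) (Z+Y≡X u w) ⟩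
    (X u w + qX u w) + qY u w                       ≡⟨ cong (_+ qY u w) (M+q≡p polyX u w) ⟩
    evalFrom (p polyX) 0 u w + qY u w               ≡⟨ evalFrom-⊕ (p polyX) (q polyY) 0 u w ⟨
    evalFrom (p polyX ⊕ q polyY) 0 u w              ∎ }
    where
    open ≡-Reasoning
    qX = evalFrom (q polyX) 0
    qY = evalFrom (q polyY) 0

  polynomial-diagonal : WalkRegular G → ∀ {M} → PolynomialInA M → ∀ u w → M u u ≡ M w w
  polynomial-diagonal wr {M} poly u w = +-cancelʳ-≡ (evalFrom (q poly) 0 u u) (M u u) (M w w) (begin
    M u u + evalFrom (q poly) 0 u u  ≡⟨ M+q≡p poly u u ⟩
    evalFrom (p poly) 0 u u          ≡⟨ evalFrom-diagonal wr (p poly) 0 u w ⟩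
    evalFrom (p poly) 0 w w          ≡⟨ M+q≡p poly w w ⟨
    M w w + evalFrom (q poly) 0 w w  ≡⟨ cong (M w w +_) (evalFrom-diagonal wr (q poly) 0 w u) ⟩
    M w w + evalFrom (q poly) 0 u u  ∎)
    where open ≡-Reasoning

  nbWalks-polynomial : ∀ {d} → (∀ u → deg u ≡ d) → ∀ k → PolynomialInA (nbWalks k) × PolynomialInA (nbWalks (suc k))
  nbWalks-polynomial regular zero = polynomial-δ , polynomial-A· polynomial-δ
  nbWalks-polynomial {d} regular (suc zero) =
    polynomial-A· polynomial-δ ,
    polynomial-cancel (polynomial-A· (polynomial-A· polynomial-δ)) (polynomial-* d polynomial-δ)
      (λ u w → subst (λ e → nbWalks 2 u w + e * nbWalks 0 u w ≡ (A· nbWalks 1) u w) (regular u) (nbWalks-2 u w))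
  nbWalks-polynomial {d} regular (suc (suc j)) with nbWalks-polynomial regular (suc j)
  ... | poly₁₊ⱼ , poly₂₊ⱼ =
    poly₂₊ⱼ ,
    polynomial-cancel (polynomial-+ (polynomial-A· poly₂₊ⱼ) poly₁₊ⱼ) (polynomial-* d poly₁₊ⱼ)
      (λ u w → subst (λ e → nbWalks (3 + j) u w + e * nbWalks (1 + j) u w ≡ (A· nbWalks (2 + j)) u w + nbWalks (1 + j) u w)
                     (regular u) (nbWalks-3+ j u w))

  nbWalks-diagonal : WalkRegular G → ∀ k u w → nbWalks k u u ≡ nbWalks k w w
  nbWalks-diagonal wr k u w =
    polynomial-diagonal wr (proj₁ (nbWalks-polynomial (λ x → walkRegular⇒regular wr x u) k)) u w

  ⟦_⟧ˡ : ∀ {k} → Literal k → Vec V k → Bool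
  ⟦ i ~ j ⟧ˡ vs = adj G (lookup vs i) (lookup vs j)
  ⟦ i ≠ j ⟧ˡ vs = not ⌊ lookup vs i ≟ lookup vs j ⌋
  ⟦ i ≐ j ⟧ˡ vs = ⌊ lookup vs i ≟ lookup vs j ⌋

  ⟦_⟧ : ∀ {k} → Monomial k → Vec V k → ℕ
  ⟦ []    ⟧ vs = 1
  ⟦ l ∷ M ⟧ vs = 𝟙 (⟦ l ⟧ˡ vs) * ⟦ M ⟧ vs

  Holds : ∀ {k} → Vec V k → Monomial k → Set
  Holds vs = All (λ l → T (⟦ l ⟧ˡ vs))

  module _ {k : ℕ} {vs : Vec V k} where

    ⟦⟧-holds : ∀ {M} → Holds vs M → ⟦ M ⟧ vs ≡ 1
    ⟦⟧-holds []       = refl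
    ⟦⟧-holds {l ∷ M} (t ∷ h) = cong₂ _*_ (𝟙-T t) (⟦⟧-holds h)
      where
      𝟙-T : ∀ {b} → T b → 𝟙 b ≡ 1
      𝟙-T {true} _ = refl

    ⟦⟧-fails : ∀ {M} → ¬ Holds vs M → ⟦ M ⟧ vs ≡ 0
    ⟦⟧-fails {[]}    ¬h = contradiction [] ¬h
    ⟦⟧-fails {l ∷ M} ¬h with ⟦ l ⟧ˡ vs in eq
    ... | true  = trans (+-identityʳ (⟦ M ⟧ vs)) (⟦⟧-fails (λ h → ¬h (subst T (sym eq) _ ∷ h)))
    ... | false = refl

    holds? : ∀ M → Dec (Holds vs M)
    holds? = all? (λ l → T? (⟦ l ⟧ˡ vs))

  module _ {k : ℕ} (vs : Vec V k) where

    ⟦⟧-≡-by-cases : ∀ {M N} → (Holds vs M ⊎ Holds vs N → ⟦ M ⟧ vs ≡ ⟦ N ⟧ vs) → ⟦ M ⟧ vs ≡ ⟦ N ⟧ vs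
    ⟦⟧-≡-by-cases {M} {N} both with holds? M | holds? N
    ... | yes hM | _     = both (inj₁ hM)
    ... | no _   | yes hN = both (inj₂ hN)
    ... | no ¬hM | no ¬hN = trans (⟦⟧-fails ¬hM) (sym (⟦⟧-fails ¬hN))

    ⟦⟧-++ : ∀ M L → ⟦ M ++ L ⟧ vs ≡ ⟦ M ⟧ vs * ⟦ L ⟧ vs
    ⟦⟧-++ []      L = sym (+-identityʳ (⟦ L ⟧ vs))
    ⟦⟧-++ (l ∷ M) L = trans (cong (𝟙 (⟦ l ⟧ˡ vs) *_) (⟦⟧-++ M L)) (sym (*-assoc (𝟙 (⟦ l ⟧ˡ vs)) _ _))

    ⟦⟧-split : ∀ i j M → ⟦ M ⟧ vs ≡ ⟦ i ≠ j ∷ M ⟧ vs + ⟦ i ≐ j ∷ M ⟧ vs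
    ⟦⟧-split i j M = δᶜ-δ-split (lookup vs i) (lookup vs j) (⟦ M ⟧ vs)

  T-not-≟⇒≢ : ∀ {x y : V} → T (not ⌊ x ≟ y ⌋) → x ≢ y
  T-not-≟⇒≢ {x} {y} t x≡y with x ≟ y
  ... | no x≢y = x≢y x≡y

  ≢⇒T-not-≟ : ∀ {x y : V} → x ≢ y → T (not ⌊ x ≟ y ⌋)
  ≢⇒T-not-≟ {x} {y} x≢y with x ≟ y
  ... | yes x≡y = x≢y x≡y
  ... | no _    = _

  adj⇒≢ : ∀ {x y} → T (adj G x y) → x ≢ y
  adj⇒≢ {x} t refl = subst T (irrefl G x) t

  adj-sym : ∀ {x y} → T (adj G x y) → T (adj G y x)
  adj-sym {x} {y} = subst T (Graph.sym G x y)

  module _ {k : ℕ} {vs : Vec V k} where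

    entails-sound : ∀ m l → T (m entails l) → T (⟦ m ⟧ˡ vs) → T (⟦ l ⟧ˡ vs)
    entails-sound (i ~ j) (_ ~ _) e t with toWitness e
    ... | inj₁ (refl , refl) = t
    ... | inj₂ (refl , refl) = adj-sym t
    entails-sound (i ~ j) (_ ≠ _) e t with toWitness e
    ... | inj₁ (refl , refl) = ≢⇒T-not-≟ (adj⇒≢ t)
    ... | inj₂ (refl , refl) = ≢⇒T-not-≟ (≢-sym (adj⇒≢ t))
    entails-sound (i ≠ j) (_ ≠ _) e t with toWitness e
    ... | inj₁ (refl , refl) = t
    ... | inj₂ (refl , refl) = ≢⇒T-not-≟ (≢-sym (T-not-≟⇒≢ t))
    entails-sound (i ≐ j) (_ ≐ _) e t with toWitness e
    ... | inj₁ (refl , refl) = t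
    ... | inj₂ (refl , refl) = fromWitness (sym (toWitness t))
    entails-sound (_ ~ _) (_ ≐ _) ()
    entails-sound (_ ≠ _) (_ ~ _) ()
    entails-sound (_ ≠ _) (_ ≐ _) ()
    entails-sound (_ ≐ _) (_ ~ _) ()
    entails-sound (_ ≐ _) (_ ≠ _) ()

    ⊢-sound : ∀ M l → T (M ⊢ l) → Holds vs M → T (⟦ l ⟧ˡ vs)
    ⊢-sound []      (i ≐ j) e []      = fromWitness (cong (lookup vs) (toWitness e))
    ⊢-sound (m ∷ M) l       e (t ∷ h) with Equivalence.to T-∨ e
    ... | inj₁ m⊢l = entails-sound m l m⊢l t
    ... | inj₂ M⊢l = ⊢-sound M l M⊢l h

    ⊩-sound : ∀ M L → T (M ⊩ L) → Holds vs M → Holds vs L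
    ⊩-sound M []      _ _ = []
    ⊩-sound M (l ∷ L) e h with Equivalence.to (T-∧ {M ⊢ l}) e
    ... | M⊢l , M⊩L = ⊢-sound M l M⊢l h ∷ ⊩-sound M L M⊩L h

    adjacent : ∀ {M} → Holds vs M → ∀ i j → {T (M ⊢ i ~ j)} → T (adj G (lookup vs i) (lookup vs j))
    adjacent {M} h i j {e} = ⊢-sound M (i ~ j) e h

    distinct : ∀ {M} → Holds vs M → ∀ i j → {T (M ⊢ i ≠ j)} → lookup vs i ≢ lookup vs j
    distinct {M} h i j {e} = T-not-≟⇒≢ (⊢-sound M (i ≠ j) e h)

    equal : ∀ {M} → Holds vs M → ∀ i j → {T (M ⊢ i ≐ j)} → lookup vs i ≡ lookup vs j
    equal {M} h i j {e} = toWitness (⊢-sound M (i ≐ j) e h)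

  -- The entailment checks are implicit arguments of type T b, which Agda fills in by itself
  -- whenever b evaluates to true.
  ⟦⟧-≡ : ∀ {k} M L (vs : Vec V k) → {T (M ⊩ L)} → {T (L ⊩ M)} → ⟦ M ⟧ vs ≡ ⟦ L ⟧ vs
  ⟦⟧-≡ M L vs {M⊩L} {L⊩M} = ⟦⟧-≡-by-cases vs λ where
    (inj₁ hM) → trans (⟦⟧-holds hM) (sym (⟦⟧-holds (⊩-sound M L M⊩L hM)))
    (inj₂ hL) → trans (⟦⟧-holds (⊩-sound L M L⊩M hL)) (sym (⟦⟧-holds hL))

  ∑⟦_⟧ : ∀ {k} → Monomial (suc k) → V → ℕ
  ∑⟦_⟧ {k} M v = ∑ⱽ k (λ xs → ⟦ M ⟧ (v ∷ xs))

  ∑⟦⟧-split : ∀ {k} i j (M : Monomial (suc k)) v → ∑⟦ M ⟧ v ≡ ∑⟦ i ≠ j ∷ M ⟧ v + ∑⟦ i ≐ j ∷ M ⟧ v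
  ∑⟦⟧-split {k} i j M v = trans
    (∑ⱽ-cong k (λ xs → ⟦⟧-split (v ∷ xs) i j M))
    (∑ⱽ-distrib-+ k (λ xs → ⟦ i ≠ j ∷ M ⟧ (v ∷ xs)) (λ xs → ⟦ i ≐ j ∷ M ⟧ (v ∷ xs)))

  ∑⟦⟧-≡ : ∀ {k} (M L : Monomial (suc k)) → {T (M ⊩ L)} → {T (L ⊩ M)} → ∀ v → ∑⟦ M ⟧ v ≡ ∑⟦ L ⟧ v
  ∑⟦⟧-≡ {k} M L {M⊩L} {L⊩M} v = ∑ⱽ-cong k (λ xs → ⟦⟧-≡ M L (v ∷ xs) {M⊩L} {L⊩M})

  ∑⟦⟧-≡0 : ∀ {k} (M : Monomial (suc k)) v → (∀ xs → ¬ Holds (v ∷ xs) M) → ∑⟦ M ⟧ v ≡ 0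
  ∑⟦⟧-≡0 {k} M v fails = ∑ⱽ-zero k (λ xs → ⟦⟧-fails (fails xs))

  ∑⟦⟧-split-≐0 : ∀ {k} i j (M : Monomial (suc k)) v → (∀ xs → ¬ Holds (v ∷ xs) (i ≐ j ∷ M)) →
                 ∑⟦ M ⟧ v ≡ ∑⟦ i ≠ j ∷ M ⟧ v
  ∑⟦⟧-split-≐0 i j M v fails = begin
    ∑⟦ M ⟧ v                                 ≡⟨ ∑⟦⟧-split i j M v ⟩
    ∑⟦ i ≠ j ∷ M ⟧ v + ∑⟦ i ≐ j ∷ M ⟧ v      ≡⟨ cong (∑⟦ i ≠ j ∷ M ⟧ v +_) (∑⟦⟧-≡0 (i ≐ j ∷ M) v fails) ⟩
    ∑⟦ i ≠ j ∷ M ⟧ v + 0                     ≡⟨ +-identityʳ _ ⟩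
    ∑⟦ i ≠ j ∷ M ⟧ v                         ∎
    where open ≡-Reasoning

  -- Cycles and closed non-backtracking walks through a vertex

  sum-map-allSeqs : ∀ k (f : Vec V k → ℕ) → List.sum (map f (allSeqs G k)) ≡ ∑ⱽ k f
  sum-map-allSeqs zero    f = +-identityʳ (f [])
  sum-map-allSeqs (suc k) f = begin
    List.sum (map f (concatMap (λ x → map (x ∷_) (allSeqs G k)) (allFin N)))
      ≡⟨ sum-map-concatMap f (λ x → map (x ∷_) (allSeqs G k)) (allFin N) ⟩
    List.sum (map (λ x → List.sum (map f (map (x ∷_) (allSeqs G k)))) (allFin N))
      ≡⟨ sum-allFin (λ x → List.sum (map f (map (x ∷_) (allSeqs G k)))) ⟩
    ∑[ x < N ] List.sum (map f (map (x ∷_) (allSeqs G k)))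
      ≡⟨ sum-cong-≗ (λ x → cong List.sum (map-∘ {g = f} {f = x ∷_} (allSeqs G k))) ⟨
    ∑[ x < N ] List.sum (map (λ xs → f (x ∷ xs)) (allSeqs G k))
      ≡⟨ sum-cong-≗ (λ x → sum-map-allSeqs k (λ xs → f (x ∷ xs))) ⟩
    ∑ⱽ (suc k) f
      ∎
    where open ≡-Reasoning

  nbWeight : List V → ℕ
  nbWeight (x ∷ y ∷ z ∷ zs) = A x y * (δᶜ z x * nbWeight (y ∷ z ∷ zs))
  nbWeight (x ∷ y ∷ [])     = A x y
  nbWeight _                = 1

  ⟦nbWalkMonomial⟧ : ∀ {k} (is : List (Fin k)) (vs : Vec V k) → ⟦ nbWalkMonomial is ⟧ vs ≡ nbWeight (map (lookup vs) is)
  ⟦nbWalkMonomial⟧ (i ∷ j ∷ l ∷ is) vs =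
    cong (λ t → A (lookup vs i) (lookup vs j) * (δᶜ (lookup vs l) (lookup vs i) * t)) (⟦nbWalkMonomial⟧ (j ∷ l ∷ is) vs)
  ⟦nbWalkMonomial⟧ (i ∷ j ∷ [])     vs = *-identityʳ _
  ⟦nbWalkMonomial⟧ (i ∷ [])         vs = refl
  ⟦nbWalkMonomial⟧ []               vs = refl

  A*nbWalksFrom : ∀ j p u w →
    A p u * nbWalksFrom (suc j) p u w ≡ ∑ⱽ j (λ xs → nbWeight (p ∷ u ∷ toList xs ++ w ∷ []))
  A*nbWalksFrom zero p u w = cong (A p u *_) (begin
    ∑[ x < N ] (A u x * (δᶜ x p * δ x w))  ≡⟨ sum-cong-≗ (λ x → *-assoc (A u x) (δᶜ x p) (δ x w)) ⟨
    ∑[ x < N ] (A u x * δᶜ x p * δ x w)    ≡⟨ ∑-δʳ w (λ x → A u x * δᶜ x p) ⟩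
    A u w * δᶜ w p                         ≡⟨ *-comm (A u w) (δᶜ w p) ⟩
    δᶜ w p * A u w                         ∎)
    where open ≡-Reasoning
  A*nbWalksFrom (suc j) p u w = begin
    A p u * ∑[ x < N ] (A u x * (δᶜ x p * nbWalksFrom (suc j) u x w))
      ≡⟨ *-distribˡ-sum (A p u) (λ x → A u x * (δᶜ x p * nbWalksFrom (suc j) u x w)) ⟩
    ∑[ x < N ] (A p u * (A u x * (δᶜ x p * nbWalksFrom (suc j) u x w)))
      ≡⟨ sum-cong-≗ (λ x → cong (A p u *_) (*-CS.x∙yz≈y∙xz (A u x) (δᶜ x p) _)) ⟩
    ∑[ x < N ] (A p u * (δᶜ x p * (A u x * nbWalksFrom (suc j) u x w)))
      ≡⟨ sum-cong-≗ (λ x → cong (λ t → A p u * (δᶜ x p * t)) (A*nbWalksFrom j u x w)) ⟩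
    ∑[ x < N ] (A p u * (δᶜ x p * ∑ⱽ j (λ xs → nbWeight (u ∷ x ∷ toList xs ++ w ∷ []))))
      ≡⟨ sum-cong-≗ (λ x → trans (cong (A p u *_) (*-distribˡ-∑ⱽ j (δᶜ x p) _)) (*-distribˡ-∑ⱽ j (A p u) _)) ⟩
    ∑ⱽ (suc j) (λ xs → nbWeight (p ∷ u ∷ toList xs ++ w ∷ []))
      ∎
    where open ≡-Reasoning

  closedNbWalks-∑⟦⟧ : ∀ j v → nbWalks (2 + j) v v ≡ ∑⟦ closedNbWalk (suc j) ⟧ v
  closedNbWalks-∑⟦⟧ j v = begin
    ∑[ a < N ] (A v a * nbWalksFrom (suc j) v a v)
      ≡⟨ sum-cong-≗ (λ a → A*nbWalksFrom j v a v) ⟩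
    ∑ⱽ (suc j) (λ xs → nbWeight (toList (v ∷ xs) ++ v ∷ []))
      ≡⟨ ∑ⱽ-cong (suc j) (λ xs → sym (trans (⟦nbWalkMonomial⟧ (allFin (2 + j) ++ zero ∷ []) (v ∷ xs))
                                            (cong nbWeight (lookup-closed xs)))) ⟩
    ∑⟦ closedNbWalk (suc j) ⟧ v
      ∎
    where
    open ≡-Reasoning
    lookup-closed : ∀ xs → map (lookup (v ∷ xs)) (allFin (2 + j) ++ zero ∷ []) ≡ toList (v ∷ xs) ++ v ∷ []
    lookup-closed xs = trans (map-++ (lookup (v ∷ xs)) (allFin (2 + j)) (zero ∷ []))
                             (cong (_++ v ∷ []) (map-lookup-allFin (v ∷ xs)))

  module _ {k : ℕ} (vs : Vec V k) where

    𝟙-distinctᵇ : ∀ is → 𝟙 (distinctᵇ G (map (lookup vs) is)) ≡ ⟦ distinctMonomial is ⟧ vs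
    𝟙-distinctᵇ []       = refl
    𝟙-distinctᵇ (i ∷ is) = begin
      𝟙 (not (any (lookup vs i ≟ᵇ_) (map (lookup vs) is)) ∧ distinctᵇ G (map (lookup vs) is))
        ≡⟨ 𝟙-∧ _ (distinctᵇ G (map (lookup vs) is)) ⟩
      𝟙 (not (any (lookup vs i ≟ᵇ_) (map (lookup vs) is))) * 𝟙 (distinctᵇ G (map (lookup vs) is))
        ≡⟨ cong₂ _*_ (notAny is) (𝟙-distinctᵇ is) ⟩
      ⟦ map (i ≠_) is ⟧ vs * ⟦ distinctMonomial is ⟧ vs
        ≡⟨ ⟦⟧-++ vs (map (i ≠_) is) (distinctMonomial is) ⟨
      ⟦ map (i ≠_) is ++ distinctMonomial is ⟧ vs
        ∎
      where
      open ≡-Reasoning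
      _≟ᵇ_ : V → V → Bool
      x ≟ᵇ y = ⌊ x ≟ y ⌋
      notAny : ∀ js → 𝟙 (not (any (lookup vs i ≟ᵇ_) (map (lookup vs) js))) ≡ ⟦ map (i ≠_) js ⟧ vs
      notAny []       = refl
      notAny (j ∷ js) with lookup vs i ≟ lookup vs j
      ... | yes _ = refl
      ... | no  _ = trans (notAny js) (sym (+-identityʳ _))

    𝟙-chainᵇ : ∀ is → 𝟙 (chainᵇ G (map (lookup vs) is)) ≡ ⟦ chainMonomial is ⟧ vs
    𝟙-chainᵇ (i ∷ j ∷ is) = trans (𝟙-∧ (adj G (lookup vs i) (lookup vs j)) _)
                                  (cong (A (lookup vs i) (lookup vs j) *_) (𝟙-chainᵇ (j ∷ is)))
    𝟙-chainᵇ (i ∷ [])     = refl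
    𝟙-chainᵇ []           = refl

  cycleSeqsAt-∑⟦⟧ : ∀ j v → cycleSeqsAt G (2 + j) v ≡ ∑⟦ cycle (suc j) ⟧ v
  cycleSeqsAt-∑⟦⟧ j v = begin
    length (filterᵇ isCycle (allSeqs G (suc j)))     ≡⟨ length-filterᵇ isCycle (allSeqs G (suc j)) ⟩
    List.sum (map (𝟙 ∘ isCycle) (allSeqs G (suc j))) ≡⟨ sum-map-allSeqs (suc j) (𝟙 ∘ isCycle) ⟩
    ∑ⱽ (suc j) (𝟙 ∘ isCycle)                          ≡⟨ ∑ⱽ-cong (suc j) 𝟙-isCycle ⟩
    ∑⟦ cycle (suc j) ⟧ v                              ∎
    where
    open ≡-Reasoning
    isCycle : Vec V (suc j) → Bool
    isCycle xs = isCycleSeqᵇ G v (toList xs)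
    𝟙-isCycle : ∀ xs → 𝟙 (isCycle xs) ≡ ⟦ cycle (suc j) ⟧ (v ∷ xs)
    𝟙-isCycle xs = begin
      𝟙 (distinctᵇ G (toList (v ∷ xs)) ∧ chainᵇ G (toList (v ∷ xs) ++ v ∷ []))
        ≡⟨ 𝟙-∧ (distinctᵇ G (toList (v ∷ xs))) _ ⟩
      𝟙 (distinctᵇ G (toList (v ∷ xs))) * 𝟙 (chainᵇ G (toList (v ∷ xs) ++ v ∷ []))
        ≡⟨ cong₂ (λ ys zs → 𝟙 (distinctᵇ G ys) * 𝟙 (chainᵇ G zs)) (sym vertices) (sym closedVertices) ⟩
      𝟙 (distinctᵇ G (map ρ (allFin (2 + j)))) * 𝟙 (chainᵇ G (map ρ (allFin (2 + j) ++ zero ∷ [])))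
        ≡⟨ cong₂ _*_ (𝟙-distinctᵇ (v ∷ xs) (allFin (2 + j))) (𝟙-chainᵇ (v ∷ xs) (allFin (2 + j) ++ zero ∷ [])) ⟩
      ⟦ distinctMonomial (allFin (2 + j)) ⟧ (v ∷ xs) * ⟦ chainMonomial (allFin (2 + j) ++ zero ∷ []) ⟧ (v ∷ xs)
        ≡⟨ ⟦⟧-++ (v ∷ xs) (distinctMonomial (allFin (2 + j))) _ ⟨
      ⟦ cycle (suc j) ⟧ (v ∷ xs)
        ∎
      where
      ρ = lookup (v ∷ xs)
      vertices : map ρ (allFin (2 + j)) ≡ toList (v ∷ xs)
      vertices = map-lookup-allFin (v ∷ xs)
      closedVertices : map ρ (allFin (2 + j) ++ zero ∷ []) ≡ toList (v ∷ xs) ++ v ∷ []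
      closedVertices = trans (map-++ ρ (allFin (2 + j)) (zero ∷ [])) (cong (_++ v ∷ []) vertices)

  cycleSeqsAt≡nbWalks : ∀ j → {T (cycle (suc j) ⊩ closedNbWalk (suc j))} → {T (closedNbWalk (suc j) ⊩ cycle (suc j))} →
                        ∀ v → cycleSeqsAt G (2 + j) v ≡ nbWalks (2 + j) v v
  cycleSeqsAt≡nbWalks j {c⊩w} {w⊩c} v = begin
    cycleSeqsAt G (2 + j) v      ≡⟨ cycleSeqsAt-∑⟦⟧ j v ⟩
    ∑⟦ cycle (suc j) ⟧ v         ≡⟨ ∑⟦⟧-≡ (cycle (suc j)) (closedNbWalk (suc j)) {c⊩w} {w⊩c} v ⟩
    ∑⟦ closedNbWalk (suc j) ⟧ v  ≡⟨ closedNbWalks-∑⟦⟧ j v ⟨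
    nbWalks (2 + j) v v          ∎
    where open ≡-Reasoning

  -- closed non-backtracking walks v a ⋯ a v that return along their first edge
  tadpoles : ∀ k → V → ℕ
  tadpoles k v = ∑⟦ fromℕ (suc k) ≐ suc zero ∷ closedNbWalk (suc k) ⟧ v

  cycles+tadpoles-5 : ∀ v → cycleSeqsAt G 5 v + tadpoles 3 v ≡ nbWalks 5 v v
  cycles+tadpoles-5 v = begin
    cycleSeqsAt G 5 v + tadpoles 3 v                ≡⟨ cong (_+ tadpoles 3 v) (cycleSeqsAt-∑⟦⟧ 3 v) ⟩
    ∑⟦ cycle 4 ⟧ v + tadpoles 3 v                   ≡⟨ cong (_+ tadpoles 3 v) (∑⟦⟧-≡ (cycle 4) W v) ⟩
    ∑⟦ 4 ≠ 1 ∷ closedNbWalk 4 ⟧ v + tadpoles 3 v    ≡⟨ ∑⟦⟧-split 4 1 (closedNbWalk 4) v ⟨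
    ∑⟦ closedNbWalk 4 ⟧ v                           ≡⟨ closedNbWalks-∑⟦⟧ 3 v ⟨
    nbWalks 5 v v                                   ∎
    where
    open ≡-Reasoning
    W = 4 ≠ 1 ∷ closedNbWalk 4

  edge+closedNbWalk₃ : Monomial 4
  edge+closedNbWalk₃ = 0 ~ 1 ∷ closedNbWalk 2 at (1 ∷ 2 ∷ 3 ∷ [])

  -- A closed walk at a, preceded by the edge v a, is a tadpole at v unless its first or last step
  -- uses v; in those two cases it is a rotation of a closed walk at v.
  ∑A*nbWalks-3 : ∀ v → tadpoles 3 v + (nbWalks 3 v v + nbWalks 3 v v) ≡ ∑[ a < N ] (A v a * nbWalks 3 a a)
  ∑A*nbWalks-3 v = sym (begin
    ∑[ a < N ] (A v a * nbWalks 3 a a)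
      ≡⟨ sum-cong-≗ (λ a → trans (cong (A v a *_) (closedNbWalks-∑⟦⟧ 1 a))
                                 (*-distribˡ-∑ⱽ 2 (A v a) (λ xs → ⟦ closedNbWalk 2 ⟧ (a ∷ xs)))) ⟩
    ∑⟦ E ⟧ v
      ≡⟨ ∑⟦⟧-split 2 0 E v ⟩
    ∑⟦ 2 ≠ 0 ∷ E ⟧ v + ∑⟦ 2 ≐ 0 ∷ E ⟧ v
      ≡⟨ cong (_+ ∑⟦ 2 ≐ 0 ∷ E ⟧ v) (∑⟦⟧-split 3 0 (2 ≠ 0 ∷ E) v) ⟩
    ∑⟦ 3 ≠ 0 ∷ 2 ≠ 0 ∷ E ⟧ v + ∑⟦ 3 ≐ 0 ∷ 2 ≠ 0 ∷ E ⟧ v + ∑⟦ 2 ≐ 0 ∷ E ⟧ v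
      ≡⟨ cong₂ _+_ (cong₂ _+_ returnsAlongFirstEdge endsAtV) startsAtV ⟩
    tadpoles 3 v + nbWalks 3 v v + nbWalks 3 v v
      ≡⟨ +-assoc (tadpoles 3 v) _ _ ⟩
    tadpoles 3 v + (nbWalks 3 v v + nbWalks 3 v v)
      ∎)
    where
    open ≡-Reasoning
    E = edge+closedNbWalk₃
    returnsAlongFirstEdge : ∑⟦ 3 ≠ 0 ∷ 2 ≠ 0 ∷ E ⟧ v ≡ tadpoles 3 v
    returnsAlongFirstEdge = sum-cong-≗ λ a → sum-cong-≗ λ b → sum-cong-≗ λ c → sym (trans
      (∑-δ a (λ e → ⟦ closedNbWalk 4 ⟧ (v ∷ a ∷ b ∷ c ∷ e ∷ [])))
      (⟦⟧-≡ (closedNbWalk 4 at (0 ∷ 1 ∷ 2 ∷ 3 ∷ 1 ∷ [])) (3 ≠ 0 ∷ 2 ≠ 0 ∷ E) (v ∷ a ∷ b ∷ c ∷ [])))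
    endsAtV : ∑⟦ 3 ≐ 0 ∷ 2 ≠ 0 ∷ E ⟧ v ≡ nbWalks 3 v v
    endsAtV = trans (sum-cong-≗ λ a → sum-cong-≗ λ b → trans
      (∑-δ v (λ c → ⟦ 2 ≠ 0 ∷ E ⟧ (v ∷ a ∷ b ∷ c ∷ [])))
      (⟦⟧-≡ ((2 ≠ 0 ∷ E) at (0 ∷ 1 ∷ 2 ∷ 0 ∷ [])) (closedNbWalk 2) (v ∷ a ∷ b ∷ [])))
      (sym (closedNbWalks-∑⟦⟧ 1 v))
    startsAtV : ∑⟦ 2 ≐ 0 ∷ E ⟧ v ≡ nbWalks 3 v v
    startsAtV = begin
      ∑⟦ 2 ≐ 0 ∷ E ⟧ v
        ≡⟨ sum-cong-≗ (λ a → ∑ⱽ-δ 1 v (λ b cs → ⟦ E ⟧ (v ∷ a ∷ b ∷ cs))) ⟩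
      ∑[ a < N ] ∑[ c < N ] ⟦ E ⟧ (v ∷ a ∷ v ∷ c ∷ [])
        ≡⟨ sum-cong-≗ (λ a → sum-cong-≗ λ c →
             ⟦⟧-≡ (E at (0 ∷ 1 ∷ 0 ∷ 2 ∷ [])) (closedNbWalk 2 at (0 ∷ 2 ∷ 1 ∷ [])) (v ∷ a ∷ c ∷ [])) ⟩
      ∑[ a < N ] ∑[ c < N ] ⟦ closedNbWalk 2 ⟧ (v ∷ c ∷ a ∷ [])
        ≡⟨ ∑-comm (λ a c → ⟦ closedNbWalk 2 ⟧ (v ∷ c ∷ a ∷ [])) ⟩
      ∑⟦ closedNbWalk 2 ⟧ v
        ≡⟨ closedNbWalks-∑⟦⟧ 1 v ⟨
      nbWalks 3 v v
        ∎

  edge+closedNbWalk₄ : Monomial 5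
  edge+closedNbWalk₄ = 0 ~ 1 ∷ closedNbWalk 3 at (1 ∷ 2 ∷ 3 ∷ 4 ∷ [])

  ∑A*nbWalks-4 : ∀ v → tadpoles 4 v + (nbWalks 4 v v + nbWalks 4 v v) ≡ ∑[ a < N ] (A v a * nbWalks 4 a a)
  ∑A*nbWalks-4 v = sym (begin
    ∑[ a < N ] (A v a * nbWalks 4 a a)
      ≡⟨ sum-cong-≗ (λ a → trans (cong (A v a *_) (closedNbWalks-∑⟦⟧ 2 a))
                                 (*-distribˡ-∑ⱽ 3 (A v a) (λ xs → ⟦ closedNbWalk 3 ⟧ (a ∷ xs)))) ⟩
    ∑⟦ E ⟧ v
      ≡⟨ ∑⟦⟧-split 2 0 E v ⟩
    ∑⟦ 2 ≠ 0 ∷ E ⟧ v + ∑⟦ 2 ≐ 0 ∷ E ⟧ v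
      ≡⟨ cong (_+ ∑⟦ 2 ≐ 0 ∷ E ⟧ v) (∑⟦⟧-split 4 0 (2 ≠ 0 ∷ E) v) ⟩
    ∑⟦ 4 ≠ 0 ∷ 2 ≠ 0 ∷ E ⟧ v + ∑⟦ 4 ≐ 0 ∷ 2 ≠ 0 ∷ E ⟧ v + ∑⟦ 2 ≐ 0 ∷ E ⟧ v
      ≡⟨ cong₂ _+_ (cong₂ _+_ returnsAlongFirstEdge endsAtV) startsAtV ⟩
    tadpoles 4 v + nbWalks 4 v v + nbWalks 4 v v
      ≡⟨ +-assoc (tadpoles 4 v) _ _ ⟩
    tadpoles 4 v + (nbWalks 4 v v + nbWalks 4 v v)
      ∎)
    where
    open ≡-Reasoning
    E = edge+closedNbWalk₄
    returnsAlongFirstEdge : ∑⟦ 4 ≠ 0 ∷ 2 ≠ 0 ∷ E ⟧ v ≡ tadpoles 4 v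
    returnsAlongFirstEdge = sum-cong-≗ λ a → sum-cong-≗ λ b → sum-cong-≗ λ c → sum-cong-≗ λ e → sym (trans
      (∑-δ a (λ f → ⟦ closedNbWalk 5 ⟧ (v ∷ a ∷ b ∷ c ∷ e ∷ f ∷ [])))
      (⟦⟧-≡ (closedNbWalk 5 at (0 ∷ 1 ∷ 2 ∷ 3 ∷ 4 ∷ 1 ∷ [])) (4 ≠ 0 ∷ 2 ≠ 0 ∷ E) (v ∷ a ∷ b ∷ c ∷ e ∷ [])))
    endsAtV : ∑⟦ 4 ≐ 0 ∷ 2 ≠ 0 ∷ E ⟧ v ≡ nbWalks 4 v v
    endsAtV = trans (sum-cong-≗ λ a → sum-cong-≗ λ b → sum-cong-≗ λ c → trans
      (∑-δ v (λ e → ⟦ 2 ≠ 0 ∷ E ⟧ (v ∷ a ∷ b ∷ c ∷ e ∷ [])))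
      (⟦⟧-≡ ((2 ≠ 0 ∷ E) at (0 ∷ 1 ∷ 2 ∷ 3 ∷ 0 ∷ [])) (closedNbWalk 3) (v ∷ a ∷ b ∷ c ∷ [])))
      (sym (closedNbWalks-∑⟦⟧ 2 v))
    startsAtV : ∑⟦ 2 ≐ 0 ∷ E ⟧ v ≡ nbWalks 4 v v
    startsAtV = begin
      ∑⟦ 2 ≐ 0 ∷ E ⟧ v
        ≡⟨ sum-cong-≗ (λ a → ∑ⱽ-δ 2 v (λ b ces → ⟦ E ⟧ (v ∷ a ∷ b ∷ ces))) ⟩
      ∑[ a < N ] ∑[ c < N ] ∑[ e < N ] ⟦ E ⟧ (v ∷ a ∷ v ∷ c ∷ e ∷ [])
        ≡⟨ sum-cong-≗ (λ a → sum-cong-≗ λ c → sum-cong-≗ λ e →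
             ⟦⟧-≡ (E at (0 ∷ 1 ∷ 0 ∷ 2 ∷ 3 ∷ [])) (closedNbWalk 3 at (0 ∷ 2 ∷ 3 ∷ 1 ∷ [])) (v ∷ a ∷ c ∷ e ∷ [])) ⟩
      ∑[ a < N ] ∑[ c < N ] ∑[ e < N ] ⟦ closedNbWalk 3 ⟧ (v ∷ c ∷ e ∷ a ∷ [])
        ≡⟨ ∑-comm (λ a c → ∑[ e < N ] ⟦ closedNbWalk 3 ⟧ (v ∷ c ∷ e ∷ a ∷ [])) ⟩
      ∑[ c < N ] ∑[ a < N ] ∑[ e < N ] ⟦ closedNbWalk 3 ⟧ (v ∷ c ∷ e ∷ a ∷ [])
        ≡⟨ sum-cong-≗ (λ c → ∑-comm (λ a e → ⟦ closedNbWalk 3 ⟧ (v ∷ c ∷ e ∷ a ∷ []))) ⟩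
      ∑⟦ closedNbWalk 3 ⟧ v
        ≡⟨ closedNbWalks-∑⟦⟧ 2 v ⟨
      nbWalks 4 v v
        ∎

  Triangle : V → V → V → Set
  Triangle x p q = T (adj G x p) × T (adj G p q) × T (adj G q x)

  triangle-swap : ∀ {x p q} → Triangle x p q → Triangle x q p
  triangle-swap (xp , pq , qx) = adj-sym qx , adj-sym pq , adj-sym xp

  triangle-closedNbWalk : ∀ {x p q} → Triangle x p q → ⟦ closedNbWalk 2 ⟧ (x ∷ p ∷ q ∷ []) ≡ 1
  triangle-closedNbWalk {x} {p} {q} (xp , pq , qx) =
    ⟦⟧-holds (⊩-sound {vs = x ∷ p ∷ q ∷ []} triangle (closedNbWalk 2) _ (xp ∷ pq ∷ qx ∷ []))
    where
    triangle : Monomial 3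
    triangle = 0 ~ 1 ∷ 1 ~ 2 ∷ 2 ~ 0 ∷ []

  module _ {x : V} where

    private
      trianglesVia : V → ℕ
      trianglesVia a = ∑[ b < N ] ⟦ closedNbWalk 2 ⟧ (x ∷ a ∷ b ∷ [])

      atLeastOne : ∀ {p q} → Triangle x p q → 1 ≤ trianglesVia p
      atLeastOne {p} {q} t =
        length-≤-∑ {xs = q ∷ []} (λ b → ⟦ closedNbWalk 2 ⟧ (x ∷ p ∷ b ∷ [])) ([] ∷ []) (triangle-closedNbWalk t ∷ [])

      atLeastTwo : ∀ {p q s} → Triangle x p q → Triangle x p s → q ≢ s → 2 ≤ trianglesVia p
      atLeastTwo {p} {q} {s} t t′ q≢s =
        length-≤-∑ {xs = q ∷ s ∷ []} (λ b → ⟦ closedNbWalk 2 ⟧ (x ∷ p ∷ b ∷ [])) ((q≢s ∷ []) ∷ [] ∷ [])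
                   (triangle-closedNbWalk t ∷ triangle-closedNbWalk t′ ∷ [])

    triangles-sharing-edge : ∀ {p q s} → Triangle x p q → Triangle x p s → q ≢ s → 4 ≤ nbWalks 3 x x
    triangles-sharing-edge {p} {q} {s} t@(_ , pq , _) t′@(_ , ps , _) q≢s = begin
      4
        ≤⟨ +-mono-≤ (atLeastTwo t t′ q≢s)
             (+-mono-≤ (atLeastOne (triangle-swap t)) (+-mono-≤ (atLeastOne (triangle-swap t′)) z≤n)) ⟩
      trianglesVia p + (trianglesVia q + (trianglesVia s + 0))
        ≤⟨ sum-map-≤-∑ trianglesVia ((adj⇒≢ pq ∷ adj⇒≢ ps ∷ []) ∷ (q≢s ∷ []) ∷ [] ∷ []) ⟩
      ∑[ a < N ] trianglesVia a
        ≡⟨ closedNbWalks-∑⟦⟧ 1 x ⟨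
      nbWalks 3 x x
        ∎
      where open ≤-Reasoning

    triangles-disjoint : ∀ {p q r s} → Triangle x p q → Triangle x r s →
                         p ≢ r → p ≢ s → q ≢ r → q ≢ s → 4 ≤ nbWalks 3 x x
    triangles-disjoint {p} {q} {r} {s} t@(_ , pq , _) t′@(_ , rs , _) p≢r p≢s q≢r q≢s = begin
      4
        ≤⟨ +-mono-≤ (atLeastOne t) (+-mono-≤ (atLeastOne (triangle-swap t))
             (+-mono-≤ (atLeastOne t′) (+-mono-≤ (atLeastOne (triangle-swap t′)) z≤n))) ⟩
      trianglesVia p + (trianglesVia q + (trianglesVia r + (trianglesVia s + 0)))
        ≤⟨ sum-map-≤-∑ trianglesVia
             ((adj⇒≢ pq ∷ p≢r ∷ p≢s ∷ []) ∷ (q≢r ∷ q≢s ∷ []) ∷ (adj⇒≢ rs ∷ []) ∷ [] ∷ []) ⟩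
      ∑[ a < N ] trianglesVia a
        ≡⟨ closedNbWalks-∑⟦⟧ 1 x ⟨
      nbWalks 3 x x
        ∎
      where open ≤-Reasoning

    triangles-coincide : nbWalks 3 x x ≤ 3 → ∀ {p q r s} → Triangle x p q → Triangle x r s →
                         (r ≡ p × s ≡ q) ⊎ (r ≡ q × s ≡ p)
    triangles-coincide ≤3 {p} {q} {r} {s} t t′ with r ≟ p | r ≟ q | s ≟ p | s ≟ q
    ... | yes refl | _        | _        | yes refl = inj₁ (refl , refl)
    ... | yes refl | _        | _        | no s≢q   = ⊥-elim (≤⇒≯ ≤3 (triangles-sharing-edge t t′ (≢-sym s≢q)))
    ... | no _     | yes refl | yes refl | _        = inj₂ (refl , refl)
    ... | no _     | yes refl | no s≢p   | _        =
      ⊥-elim (≤⇒≯ ≤3 (triangles-sharing-edge (triangle-swap t) t′ (≢-sym s≢p)))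
    ... | no r≢p   | no r≢q   | yes refl | _        =
      ⊥-elim (≤⇒≯ ≤3 (triangles-sharing-edge t (triangle-swap t′) (≢-sym r≢q)))
    ... | no r≢p   | no r≢q   | no s≢p   | yes refl =
      ⊥-elim (≤⇒≯ ≤3 (triangles-sharing-edge (triangle-swap t) (triangle-swap t′) (≢-sym r≢p)))
    ... | no r≢p   | no r≢q   | no s≢p   | no s≢q   =
      ⊥-elim (≤⇒≯ ≤3 (triangles-disjoint t t′ (≢-sym r≢p) (≢-sym s≢p) (≢-sym r≢q) (≢-sym s≢q)))

  module _ (atMostOneTriangle : ∀ x → nbWalks 3 x x ≤ 3) where

    private
      W₁ W₂ W₃ : Monomial 6
      W₁ = 5 ≠ 1 ∷ closedNbWalk 5
      W₂ = 3 ≠ 0 ∷ W₁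
      W₃ = 4 ≠ 1 ∷ W₂

      twice : Monomial 6
      twice = 4 ≐ 1 ∷ 5 ≐ 2 ∷ closedNbWalk 2 at (0 ∷ 1 ∷ 2 ∷ [])

      sameTriangleTwice : ∀ v a b →
        ⟦ W₁ ⟧ (v ∷ a ∷ b ∷ v ∷ a ∷ b ∷ []) ≡ ⟦ twice ⟧ (v ∷ a ∷ b ∷ v ∷ a ∷ b ∷ [])
      sameTriangleTwice v a b = ⟦⟧-≡ (W₁ at σ) (twice at σ) (v ∷ a ∷ b ∷ [])
        where σ = 0 ∷ 1 ∷ 2 ∷ 0 ∷ 1 ∷ 2 ∷ []

      figureEight-cases : ∀ v a b e f →
        Holds (v ∷ a ∷ b ∷ v ∷ e ∷ f ∷ []) W₁ ⊎ Holds (v ∷ a ∷ b ∷ v ∷ e ∷ f ∷ []) twice →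
        ⟦ W₁ ⟧ (v ∷ a ∷ b ∷ v ∷ e ∷ f ∷ []) ≡ ⟦ twice ⟧ (v ∷ a ∷ b ∷ v ∷ e ∷ f ∷ [])
      figureEight-cases v a b e f (inj₁ h) with triangles-coincide (atMostOneTriangle v)
                                                  (adjacent h 0 1 , adjacent h 1 2 , adjacent h 2 3)
                                                  (adjacent h 3 4 , adjacent h 4 5 , adjacent h 5 0)
      ... | inj₁ (refl , refl) = sameTriangleTwice v a b
      ... | inj₂ (_ , f≡a)     = ⊥-elim (distinct h 5 1 f≡a)
      figureEight-cases v a b e f (inj₂ h) with equal h 4 1 | equal h 5 2
      ... | refl | refl = sameTriangleTwice v a b

    -- The triangles v a b and v e f coincide, and f ≠ a leaves only e = a and f = b.
    figureEight : ∀ v a b e f →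
      ⟦ W₁ ⟧ (v ∷ a ∷ b ∷ v ∷ e ∷ f ∷ []) ≡ δ e a * (δ f b * ⟦ closedNbWalk 2 ⟧ (v ∷ a ∷ b ∷ []))
    figureEight v a b e f = ⟦⟧-≡-by-cases (v ∷ a ∷ b ∷ v ∷ e ∷ f ∷ []) (figureEight-cases v a b e f)

    -- v a b c a f v and v a b c e b v would contain two different triangles through a, resp. b.
    noSecondTriangleAt₁ : ∀ v xs → ¬ Holds (v ∷ xs) (4 ≐ 1 ∷ W₂)
    noSecondTriangleAt₁ v (a ∷ b ∷ c ∷ e ∷ f ∷ []) h with equal h 4 1
    ... | refl with triangles-coincide (atMostOneTriangle a)
                      (adjacent h 1 2 , adjacent h 2 3 , adjacent h 3 4)
                      (adjacent h 4 5 , adjacent h 5 0 , adjacent h 0 1)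
    ...   | inj₁ (_ , v≡c) = distinct h 3 0 (sym v≡c)
    ...   | inj₂ (_ , v≡b) = distinct h 2 0 (sym v≡b)

    noSecondTriangleAt₂ : ∀ v xs → ¬ Holds (v ∷ xs) (5 ≐ 2 ∷ W₃)
    noSecondTriangleAt₂ v (a ∷ b ∷ c ∷ e ∷ f ∷ []) h with equal h 5 2
    ... | refl with triangles-coincide (atMostOneTriangle b)
                      (adjacent h 2 3 , adjacent h 3 4 , adjacent h 4 5)
                      (adjacent h 5 0 , adjacent h 0 1 , adjacent h 1 2)
    ...   | inj₁ (v≡c , _) = distinct h 3 0 (sym v≡c)
    ...   | inj₂ (_ , a≡c) = distinct h 3 1 (sym a≡c)

    cycles+figureEights+tadpoles-6 : ∀ v → cycleSeqsAt G 6 v + (nbWalks 3 v v + tadpoles 4 v) ≡ nbWalks 6 v v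
    cycles+figureEights+tadpoles-6 v = begin
      cycleSeqsAt G 6 v + (nbWalks 3 v v + tadpoles 4 v)  ≡⟨ +-assoc (cycleSeqsAt G 6 v) _ _ ⟨
      cycleSeqsAt G 6 v + nbWalks 3 v v + tadpoles 4 v    ≡⟨ cong₂ (λ c e → c + e + tadpoles 4 v) cycles figureEights ⟩
      ∑⟦ W₂ ⟧ v + ∑⟦ 3 ≐ 0 ∷ W₁ ⟧ v + tadpoles 4 v        ≡⟨ cong (_+ tadpoles 4 v) (∑⟦⟧-split 3 0 W₁ v) ⟨
      ∑⟦ W₁ ⟧ v + tadpoles 4 v                            ≡⟨ ∑⟦⟧-split 5 1 (closedNbWalk 5) v ⟨
      ∑⟦ closedNbWalk 5 ⟧ v                               ≡⟨ closedNbWalks-∑⟦⟧ 4 v ⟨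
      nbWalks 6 v v                                       ∎
      where
      open ≡-Reasoning
      cycles : cycleSeqsAt G 6 v ≡ ∑⟦ W₂ ⟧ v
      cycles = begin
        cycleSeqsAt G 6 v          ≡⟨ cycleSeqsAt-∑⟦⟧ 4 v ⟩
        ∑⟦ cycle 5 ⟧ v             ≡⟨ ∑⟦⟧-≡ (cycle 5) (5 ≠ 2 ∷ W₃) v ⟩
        ∑⟦ 5 ≠ 2 ∷ W₃ ⟧ v          ≡⟨ ∑⟦⟧-split-≐0 5 2 W₃ v (noSecondTriangleAt₂ v) ⟨
        ∑⟦ W₃ ⟧ v                  ≡⟨ ∑⟦⟧-split-≐0 4 1 W₂ v (noSecondTriangleAt₁ v) ⟨
        ∑⟦ W₂ ⟧ v                  ∎
      figureEights : nbWalks 3 v v ≡ ∑⟦ 3 ≐ 0 ∷ W₁ ⟧ v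
      figureEights = sym (begin
        ∑⟦ 3 ≐ 0 ∷ W₁ ⟧ v
          ≡⟨ sum-cong-≗ (λ a → sum-cong-≗ λ b → ∑ⱽ-δ 2 v (λ c efs → ⟦ W₁ ⟧ (v ∷ a ∷ b ∷ c ∷ efs))) ⟩
        ∑[ a < N ] ∑[ b < N ] ∑[ e < N ] ∑[ f < N ] ⟦ W₁ ⟧ (v ∷ a ∷ b ∷ v ∷ e ∷ f ∷ [])
          ≡⟨ sum-cong-≗ (λ a → sum-cong-≗ λ b → sum-cong-≗ λ e → sum-cong-≗ λ f → figureEight v a b e f) ⟩
        ∑[ a < N ] ∑[ b < N ] ∑[ e < N ] ∑[ f < N ] (δ e a * (δ f b * ⟦ closedNbWalk 2 ⟧ (v ∷ a ∷ b ∷ [])))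
          ≡⟨ sum-cong-≗ (λ a → sum-cong-≗ λ b → trans
               (∑ⱽ-δ 1 a (λ { _ (f ∷ []) → δ f b * ⟦ closedNbWalk 2 ⟧ (v ∷ a ∷ b ∷ []) }))
               (∑-δ b (λ _ → ⟦ closedNbWalk 2 ⟧ (v ∷ a ∷ b ∷ [])))) ⟩
        ∑⟦ closedNbWalk 2 ⟧ v
          ≡⟨ closedNbWalks-∑⟦⟧ 1 v ⟨
        nbWalks 3 v v
          ∎)

  invariant-by-difference : {X Y Z : V → ℕ} → (∀ u w → Y u ≡ Y w) → (∀ u w → Z u ≡ Z w) →
                            (∀ v → X v + Z v ≡ Y v) → ∀ u w → X u ≡ X w
  invariant-by-difference {X} {Y} {Z} Y-inv Z-inv X+Z≡Y u w = +-cancelʳ-≡ (Z w) (X u) (X w) (begin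
    X u + Z w  ≡⟨ cong (X u +_) (Z-inv u w) ⟨
    X u + Z u  ≡⟨ X+Z≡Y u ⟩
    Y u        ≡⟨ Y-inv u w ⟩
    Y w        ≡⟨ X+Z≡Y w ⟨
    X w + Z w  ∎)
    where open ≡-Reasoning

  module _ (wr : WalkRegular G) where

    ∑A*-invariant : {Y : V → ℕ} → (∀ u w → Y u ≡ Y w) →
                    ∀ u w → ∑[ a < N ] (A u a * Y a) ≡ ∑[ a < N ] (A w a * Y a)
    ∑A*-invariant {Y} Y-inv u w = begin
      ∑[ a < N ] (A u a * Y a)  ≡⟨ sum-cong-≗ (λ a → cong (A u a *_) (Y-inv a u)) ⟩
      ∑[ a < N ] (A u a * Y u)  ≡⟨ *-distribʳ-sum (Y u) (A u) ⟨
      deg u * Y u               ≡⟨ cong₂ _*_ (walkRegular⇒regular wr u w) (Y-inv u w) ⟩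
      deg w * Y w               ≡⟨ *-distribʳ-sum (Y w) (A w) ⟩
      ∑[ a < N ] (A w a * Y w)  ≡⟨ sum-cong-≗ (λ a → cong (A w a *_) (Y-inv a w)) ⟨
      ∑[ a < N ] (A w a * Y a)  ∎
      where open ≡-Reasoning

    tadpoles-invariant : ∀ k → (∀ v → tadpoles k v + (nbWalks k v v + nbWalks k v v) ≡ ∑[ a < N ] (A v a * nbWalks k a a)) →
                         ∀ u w → tadpoles k u ≡ tadpoles k w
    tadpoles-invariant k identity = invariant-by-difference
      (∑A*-invariant (nbWalks-diagonal wr k))
      (λ u w → cong₂ _+_ (nbWalks-diagonal wr k u w) (nbWalks-diagonal wr k u w))
      identity

    cycleSeqsAt-invariant : ∀ j → {T (cycle (suc j) ⊩ closedNbWalk (suc j))} → {T (closedNbWalk (suc j) ⊩ cycle (suc j))} →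
                            ∀ u w → cycleSeqsAt G (2 + j) u ≡ cycleSeqsAt G (2 + j) w
    cycleSeqsAt-invariant j {c⊩w} {w⊩c} u w = begin
      cycleSeqsAt G (2 + j) u  ≡⟨ cycleSeqsAt≡nbWalks j {c⊩w} {w⊩c} u ⟩
      nbWalks (2 + j) u u      ≡⟨ nbWalks-diagonal wr (2 + j) u w ⟩
      nbWalks (2 + j) w w      ≡⟨ cycleSeqsAt≡nbWalks j {c⊩w} {w⊩c} w ⟨
      cycleSeqsAt G (2 + j) w  ∎
      where open ≡-Reasoning

    cycleSeqsAt-invariant-5 : ∀ u w → cycleSeqsAt G 5 u ≡ cycleSeqsAt G 5 w
    cycleSeqsAt-invariant-5 = invariant-by-difference (nbWalks-diagonal wr 5) (tadpoles-invariant 3 ∑A*nbWalks-3) cycles+tadpoles-5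

    cycleSeqsAt-invariant-6 : (∀ x → nbWalks 3 x x ≤ 3) → ∀ u w → cycleSeqsAt G 6 u ≡ cycleSeqsAt G 6 w
    cycleSeqsAt-invariant-6 atMostOneTriangle = invariant-by-difference (nbWalks-diagonal wr 6)
      (λ u w → cong₂ _+_ (nbWalks-diagonal wr 3 u w) (tadpoles-invariant 4 ∑A*nbWalks-4 u w))
      (cycles+figureEights+tadpoles-6 atMostOneTriangle)

lemma4p1 : (G : Graph) → Connected G → WalkRegular G →
    ((∀ u w → cyclesThrough G 3 u ≡ cyclesThrough G 3 w)
     × (∀ u w → cyclesThrough G 4 u ≡ cyclesThrough G 4 w)
     × (∀ u w → cyclesThrough G 5 u ≡ cyclesThrough G 5 w))
    × ((∀ v → cyclesThrough G 3 v ≤ 1) →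
       ∀ u w → cyclesThrough G 6 u ≡ cyclesThrough G 6 w)
lemma4p1 G _ wr =
  (halve 3 (cycleSeqsAt-invariant G wr 1) , halve 4 (cycleSeqsAt-invariant G wr 2) , halve 5 (cycleSeqsAt-invariant-5 G wr)) ,
  λ atMostOneTriangle → halve 6 (cycleSeqsAt-invariant-6 G wr λ x →
    subst (_≤ 3) (cycleSeqsAt≡nbWalks G 1 x) (half≤1⇒≤3 (cycleSeqsAt G 3 x) (atMostOneTriangle x)))
  where
  halve : ∀ m → (∀ u w → cycleSeqsAt G m u ≡ cycleSeqsAt G m w) → ∀ u w → cyclesThrough G m u ≡ cyclesThrough G m w
  halve m same u w = cong (_/ 2) (same u w)
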